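{- Let $p,q$ be primes with $2<p<q$, with $\kappa+\lambda<p$, such that the pair $(p,q)$ is of Type II and $\kappa+\lambda>p-\lambda$. Then $g_1+\lambda'$ is not representable, and hence $g>g_1$.
   Context: Let $p,q$ be primes with $2<p<q$, and put $p'=(p-1)/2$, $q'=(q-1)/2$. Set $d_0=pq$, $d_1=p'q$, $d_2=pq'$, $d_3=(pq-1)/2$, and for integers $x,y,z,w$ put $f(x,y,z,w)=xd_0+yd_1+zd_2+wd_3$. A positive integer is representable if it equals $f(x,y,z,w)$ for some nonnegative integers $x,y,z,w$; the Frobenius number $g$ is the largest positive integer that is not representable. Define integers $\kappa,\lambda,\kappa',\lambda'$ by $q=\kappa p+\lambda$ with $1\le\lambda\le p-1$ and $q'=\kappa'p'+\lambda'$ with $0\le\lambda'\le p'-1$. Put $g_0=f(p'-1,p-1,\kappa,-1)$ and $g_1=g_0-\lambda d_3$. When $\kappa+\lambda<p$ one has $\lambda\le p-3$ and $\lambda'\ge1$, and $\tau=\lfloor \lambda/(p-\lambda)\rfloor$ is the unique integer with $0\le\tau<\lambda$ and $\frac{\tau+2}{\tau+1}<\frac{p}{\lambda}<\frac{\tau+1}{\tau}$ (the right-hand inequality being vacuous when $\tau=0$). Such a pair is of Type I if $\frac{\tau+2}{\tau+1}<\frac{p'}{\lambda'}$ and of Type II if $\frac{p'}{\lambda'}\le\frac{\tau+2}{\tau+1}$. -}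

module Defs where

open import Data.Nat as ℕ using (ℕ; _∸_)
open import Data.Nat.DivMod using (_/_)
open import Data.Integer using (ℤ; +_; _+_; _*_; _-_; _<_; -1ℤ)
open import Data.Product using (Σ; ∃; _×_)
open import Relation.Binary.PropositionalEquality using (_≡_)
open import Relation.Nullary using (¬_)

half : ℕ → ℕ
half n = (n ∸ 1) / 2

d₀ d₁ d₂ d₃ : ℕ → ℕ → ℤ
d₀ p q = + (p ℕ.* q)
d₁ p q = + (half p ℕ.* q)
d₂ p q = + (p ℕ.* half q)
d₃ p q = + half (p ℕ.* q)

f : ℕ → ℕ → ℤ → ℤ → ℤ → ℤ → ℤ
f p q x y z w = x * d₀ p q + y * d₁ p q + z * d₂ p q + w * d₃ p q

Representable : ℕ → ℕ → ℤ → Set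
Representable p q n =
  ∃ λ (x : ℕ) → ∃ λ (y : ℕ) → ∃ λ (z : ℕ) → ∃ λ (w : ℕ) →
    n ≡ f p q (+ x) (+ y) (+ z) (+ w)

IsFrobenius : ℕ → ℕ → ℤ → Set
IsFrobenius p q g =
  (+ 0 < g) × ¬ Representable p q g ×
  (∀ n → g < n → Representable p q n)

g₀ : ℕ → ℕ → ℕ → ℤ
g₀ p q κ = f p q (+ half p - + 1) (+ p - + 1) (+ κ) -1ℤ

g₁ : ℕ → ℕ → ℕ → ℕ → ℤ
g₁ p q κ l = g₀ p q κ - + l * d₃ p q

-- Type II: p'/λ' ≤ (τ+2)/(τ+1), written by cross-multiplication
-- (both denominators λ' and τ+1 are positive in the relevant setting)
TypeII : (p' λ' τ : ℕ) → Set
TypeII p' λ' τ = p' ℕ.* (τ ℕ.+ 1) ℕ.≤ (τ ℕ.+ 2) ℕ.* λ'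

{-# OPTIONS --safe #-}
-- Doubling clears the halves in d₁, d₂, d₃: a representation n = f(x,y,z,w) gives
-- 2n + (yq + zp + w) = (2x+y+z+w)·pq.  Write the pair in the normal form p = κ + λ + σ,
-- κ + λ = 2λ' + 1, q' = κp' + λ'; then 2(g₁ + λ') + 6pq = K·pq + c with K = 3κ + λ + 2σ and
-- c = 3λ + κ.  A representation of g₁ + λ' would therefore write t·pq − c as yq + zp + w
-- with t + K = 2x + y + z + w + 6.  But every such writing costs y + z + w ≥ t + K − 5:
-- removing p from y or q from z lowers t by one, and once y < p and z < q only t = 1 is
-- not immediate; there zp + w + c is a multiple of q, and the Type II bound (τ+2)σ < p
-- controls the cost.
module Submission where

open import Defs

module NaturalArithmetic where

  open import Data.Nat
  open import Data.Nat.Properties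
  open import Data.Nat.DivMod using (_/_; _%_; m≡m%n+[m/n]*n; m%n<n; m*n/n≡m)
  open import Data.Nat.Divisibility using (divides)
  open import Data.Nat.Divisibility.Core using (hasNonTrivialDivisor)
  open import Data.Nat.Primality using (Prime)
  open import Data.Nat.Tactic.RingSolver using (solve-∀; solve)
  open import Data.List.Base using (_∷_; [])
  open import Data.Product using (_×_; _,_)
  open import Data.Sum using (inj₁; inj₂)
  open import Data.Empty using (⊥-elim)
  open import Relation.Nullary using (yes; no)
  open import Relation.Binary.Definitions using (tri<; tri≈; tri>)
  open import Relation.Binary.PropositionalEquality

  -- Linear inequalities are certified by an identity a + d + R = b + L, checked by the ring solver.
  balance⇒≤ : ∀ {a b} d {L R} → L ≤ R → a + d + R ≡ b + L → a ≤ b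
  balance⇒≤ {a} {b} d {L} {R} L≤R eq =
    ≤-trans (m≤m+n a d) (+-cancelʳ-≤ R (a + d) b (≤-trans (≤-reflexive eq) (+-monoʳ-≤ b L≤R)))

  Odd : ℕ → Set
  Odd n = n ≡ 1 + 2 * half n

  half-odd : ∀ b → half (1 + 2 * b) ≡ b
  half-odd b = trans (cong (_/ 2) (*-comm 2 b)) (m*n/n≡m b 2)

  odd-intro : ∀ {n} b → n ≡ 1 + 2 * b → Odd n
  odd-intro b refl = cong (λ x → 1 + 2 * x) (sym (half-odd b))

  odd-prime : ∀ {n} → Prime n → 2 < n → Odd n
  odd-prime {n} n-prime 2<n with n % 2 | m≡m%n+[m/n]*n n 2 | m%n<n n 2
  ... | 0 | n≡[n/2]*2 | _ =
    ⊥-elim (Prime.notComposite n-prime (hasNonTrivialDivisor 2<n (divides (n / 2) n≡[n/2]*2)))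
  ... | 1 | n≡1+[n/2]*2 | _ = odd-intro (n / 2) (trans n≡1+[n/2]*2 (cong suc (*-comm (n / 2) 2)))
  ... | suc (suc _) | _ | s≤s (s≤s ())

  half-*-odd : ∀ {p q} → Odd p → Odd q → half (p * q) ≡ 2 * half q * half p + half q + half p
  half-*-odd {p} {q} p-odd q-odd = begin
    half (p * q)                                 ≡⟨ cong half (cong₂ _*_ p-odd q-odd) ⟩
    half ((1 + 2 * b) * (1 + 2 * a))             ≡⟨ cong half (expand b a) ⟩
    half (1 + 2 * (2 * a * b + a + b))           ≡⟨ half-odd (2 * a * b + a + b) ⟩
    2 * a * b + a + b                            ∎
    where
    open ≡-Reasoning
    b a : ℕ
    b = half p
    a = half q
    expand : ∀ b a → (1 + 2 * b) * (1 + 2 * a) ≡ 1 + 2 * (2 * a * b + a + b)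
    expand = solve-∀

  quotient-<⇒< : ∀ {d m n r s} → r < d → m < n → m * d + r < n * d + s
  quotient-<⇒< {d} {m} {n} {r} {s} r<d m<n = begin-strict
    m * d + r   <⟨ +-monoʳ-< (m * d) r<d ⟩
    m * d + d   ≡⟨ +-comm (m * d) d ⟩
    suc m * d   ≤⟨ *-monoˡ-≤ d m<n ⟩
    n * d       ≤⟨ m≤m+n (n * d) s ⟩
    n * d + s   ∎
    where open ≤-Reasoning

  quotient-unique : ∀ {d m n r s} → r < d → s < d → m * d + r ≡ n * d + s → m ≡ n
  quotient-unique {m = m} {n} r<d s<d eq with <-cmp m n
  ... | tri< m<n _ _ = ⊥-elim (<-irrefl eq (quotient-<⇒< r<d m<n))
  ... | tri≈ _ m≡n _ = m≡n
  ... | tri> _ _ n<m = ⊥-elim (<-irrefl (sym eq) (quotient-<⇒< s<d n<m))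

  quotient-positive : ∀ {p q κ l} → p < q → q ≡ κ * p + l → l ≤ p → 1 ≤ κ
  quotient-positive {κ = zero} p<q refl l≤p = ⊥-elim (<-irrefl refl (<-≤-trans p<q l≤p))
  quotient-positive {κ = suc _} _ _ _ = s≤s z≤n

  normal-form : ∀ {p q κ l κ′ l′} → Odd p → Odd q → q ≡ κ * p + l → half q ≡ κ′ * half p + l′ →
                l′ < half p → κ + l < p → half q ≡ κ * half p + l′ × κ + l ≡ 1 + 2 * l′
  normal-form {p} {q} {κ} {l} {κ′} {l′} p-odd q-odd q≡κp+l q′≡κ′p′+l′ l′<p′ κ+l<p =
    trans q′≡κ′p′+l′ (cong (λ k → k * b + l′) κ′≡κ) ,
    sym (+-cancelˡ-≡ (κ * (2 * b)) _ _
      (trans (cong (λ k → k * (2 * b) + (1 + 2 * l′)) (sym κ′≡κ)) two-divisions))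
    where
    b : ℕ
    b = half p
    regroup₁ : ∀ k b l′ → k * (2 * b) + (1 + 2 * l′) ≡ 1 + 2 * (k * b + l′)
    regroup₁ = solve-∀
    two-divisions : κ′ * (2 * b) + (1 + 2 * l′) ≡ κ * (2 * b) + (κ + l)
    two-divisions = begin
      κ′ * (2 * b) + (1 + 2 * l′)  ≡⟨ regroup₁ κ′ b l′ ⟩
      1 + 2 * (κ′ * b + l′)        ≡⟨ cong (λ x → 1 + 2 * x) (sym q′≡κ′p′+l′) ⟩
      1 + 2 * half q               ≡⟨ sym q-odd ⟩
      q                            ≡⟨ q≡κp+l ⟩
      κ * p + l                    ≡⟨ cong (λ x → κ * x + l) p-odd ⟩
      κ * (1 + 2 * b) + l          ≡⟨ regroup₂ κ b l ⟩
      κ * (2 * b) + (κ + l)        ∎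
      where
      open ≡-Reasoning
      regroup₂ : ∀ k b l → k * (1 + 2 * b) + l ≡ k * (2 * b) + (k + l)
      regroup₂ = solve-∀
    1+2l′<2b : 1 + 2 * l′ < 2 * b
    1+2l′<2b = begin-strict
      1 + 2 * l′     <⟨ n<1+n _ ⟩
      2 + 2 * l′     ≡⟨ sym (*-distribˡ-+ 2 1 l′) ⟩
      2 * (1 + l′)   ≤⟨ *-monoʳ-≤ 2 l′<p′ ⟩
      2 * b          ∎
      where open ≤-Reasoning
    κ+l<2b : κ + l < 2 * b
    κ+l<2b with m≤n⇒m<n∨m≡n (≤-pred (subst (κ + l <_) p-odd κ+l<p))
    ... | inj₁ κ+l<2b = κ+l<2b
    ... | inj₂ κ+l≡2b = ⊥-elim (even≢odd (κ * b + b) (κ′ * b + l′) (begin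
      2 * (κ * b + b)              ≡⟨ regroup κ b ⟩
      κ * (2 * b) + 2 * b          ≡⟨ cong (κ * (2 * b) +_) (sym κ+l≡2b) ⟩
      κ * (2 * b) + (κ + l)        ≡⟨ sym two-divisions ⟩
      κ′ * (2 * b) + (1 + 2 * l′)  ≡⟨ regroup₁ κ′ b l′ ⟩
      1 + 2 * (κ′ * b + l′)        ∎))
      where
      open ≡-Reasoning
      regroup : ∀ k b → 2 * (k * b + b) ≡ k * (2 * b) + 2 * b
      regroup = solve-∀
    κ′≡κ : κ′ ≡ κ
    κ′≡κ = quotient-unique 1+2l′<2b κ+l<2b two-divisions

  ∸-split : ∀ {p κ l σ} → p ≡ κ + l + σ → p ∸ l ≡ κ + σ
  ∸-split {κ = κ} {l} {σ} refl = trans (cong (_∸ l) (swap κ l σ)) (m+n∸n≡m (κ + σ) l)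
    where
    swap : ∀ κ l σ → κ + l + σ ≡ κ + σ + l
    swap = solve-∀

  typeII-σ-bound : ∀ {p b l′ σ τ} → p ≡ 1 + 2 * b → p ≡ 1 + 2 * l′ + σ →
                   b * (τ + 1) ≤ (τ + 2) * l′ → (2 + τ) * σ < p
  typeII-σ-bound {b = b} {l′} {σ} {τ} refl p≡1+2l′+σ typeII =
    s≤s (balance⇒≤ 0 (*-monoʳ-≤ 2 typeII) (begin
      (2 + τ) * σ + 0 + 2 * ((τ + 2) * l′)  ≡⟨ regroup₁ τ σ l′ ⟩
      (2 + τ) * (2 * l′ + σ)                ≡⟨ cong ((2 + τ) *_) (suc-injective (sym p≡1+2l′+σ)) ⟩
      (2 + τ) * (2 * b)                     ≡⟨ regroup₂ τ b ⟩
      2 * b + 2 * (b * (τ + 1))             ∎))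
    where
    open ≡-Reasoning
    regroup₁ : ∀ τ σ l′ → (2 + τ) * σ + 0 + 2 * ((τ + 2) * l′) ≡ (2 + τ) * (2 * l′ + σ)
    regroup₁ = solve-∀
    regroup₂ : ∀ τ b → (2 + τ) * (2 * b) ≡ 2 * b + 2 * (b * (τ + 1))
    regroup₂ = solve-∀

  typeII-λ′-positive : ∀ {b l′ τ} → l′ < b → b * (τ + 1) ≤ (τ + 2) * l′ → 0 < l′
  typeII-λ′-positive {l′ = suc _} _ _ = s≤s z≤n
  typeII-λ′-positive {b} {zero} {τ} 0<b typeII =
    ⊥-elim (1+n≰n (≤-trans (*-mono-≤ 0<b (m≤n+m 1 τ))
                           (≤-trans typeII (≤-reflexive (*-zeroʳ (τ + 2))))))

  cost-bound-q : ∀ {κ l σ p q} → 1 ≤ κ → p ≡ κ + l + σ → q ≡ κ * p + l → σ < l →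
                 ∀ z w → z * p + w + (3 * l + κ) ≡ q → 2 * κ + σ + 1 ≤ z + w + 4
  cost-bound-q {suc k} {l} {σ} (s≤s z≤n) refl refl σ<l z w eq with suc z ≤? k
  ... | yes z<k with m≤n⇒∃[o]m+o≡n z<k
  ...   | e , refl =
    balance⇒≤ (1 + e + e * e + e * l + e * σ + e * z + σ) (≤-reflexive (sym eq)) (balance z e l σ w)
    where
    balance : ∀ z e l σ w →
      2 * suc (suc z + e) + σ + 1 + (1 + e + e * e + e * l + e * σ + e * z + σ)
        + (z * suc ((suc z + e) + l + σ) + w + (3 * l + suc (suc z + e)))
      ≡ z + w + 4 + suc (((suc z + e) + l + σ) + (suc z + e) * suc ((suc z + e) + l + σ) + l)
    balance = solve-∀
  cost-bound-q {suc k} {l} {σ} (s≤s z≤n) refl refl σ<l z w eq | no z≮k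
    with m≤n⇒∃[o]m+o≡n (≮⇒≥ z≮k) | m≤n⇒∃[o]m+o≡n σ<l
  ... | e , refl | f , refl = ⊥-elim (m+1+n≢m _ (trans (sym (overshoot k e σ f w)) eq))
    where
    overshoot : ∀ k e σ f w →
      (k + e) * suc (k + (suc σ + f) + σ) + w + (3 * (suc σ + f) + suc k)
      ≡ suc ((k + (suc σ + f) + σ) + k * suc (k + (suc σ + f) + σ) + (suc σ + f))
        + suc (2 * e + e * f + e * k + 2 * e * σ + f + w)
    overshoot = solve-∀

  cost-bound-2q : ∀ {κ l σ p q} → 1 ≤ κ → p ≡ κ + l + σ → q ≡ κ * p + l →
                  ∀ z w → z * p + w + (3 * l + κ) ≡ 2 * q → 2 * κ + σ + 2 ≤ z + w + 4
  cost-bound-2q {suc k} {l} {σ} (s≤s z≤n) refl refl z w eq with suc z ≤? 2 * suc k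
  ... | yes z<2κ with m≤n⇒∃[o]m+o≡n z<2κ
  ...   | e , z+e≡2κ =
    balance⇒≤ (1 + e * (k + l + σ))
      (≤-reflexive (sym (cong₂ _+_ eq (cong ((k + l + σ) *_) (sym z+e≡2κ)))))
      (balance k l σ z w e)
    where
    balance : ∀ k l σ z w e →
      2 * suc k + σ + 2 + (1 + e * (k + l + σ))
        + ((z * suc (k + l + σ) + w + (3 * l + suc k)) + (k + l + σ) * (2 * suc k))
      ≡ z + w + 4 + (2 * suc ((k + l + σ) + k * suc (k + l + σ) + l) + (k + l + σ) * (suc z + e))
    balance = solve-∀
  cost-bound-2q {suc k} {l} {σ} (s≤s z≤n) refl refl z w eq | no z≮2κ
    with m≤n⇒∃[o]m+o≡n (≮⇒≥ z≮2κ)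
  ... | e , refl = ⊥-elim (m+1+n≢m _ (trans (sym (overshoot k l σ e w)) eq))
    where
    overshoot : ∀ k l σ e w →
      (2 * suc k + e) * suc (k + l + σ) + w + (3 * l + suc k)
      ≡ 2 * suc ((k + l + σ) + k * suc (k + l + σ) + l) + suc (e + e * k + e * l + e * σ + k + l + w)
    overshoot = solve-∀

  cost-bound-[3+m]q : ∀ {κ l σ τ p q} → 1 ≤ κ → p ≡ κ + l + σ → q ≡ κ * p + l →
                      l < suc τ * (κ + σ) → (2 + τ) * σ < p →
                      ∀ m z w → z * p + w + (3 * l + κ) ≡ (3 + m) * q → 2 * κ + σ + (3 + m) ≤ z + w + 4
  cost-bound-[3+m]q {suc k} {l} {σ} {τ} {p} (s≤s z≤n) refl refl l<[1+τ][κ+σ] [2+τ]σ<p m z w eq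
    with z ≤? (m + 3) * suc k + m
  ... | yes z≤[m+3]κ+m with m≤n⇒∃[o]m+o≡n z≤[m+3]κ+m
  ...   | h , z+h≡ =
    balance⇒≤ 1
      (+-mono-≤ (≤-reflexive (sym (cong₂ _+_ eq (cong ((k + l + σ) *_) (sym z+h≡))))) mσ≤h[p-1])
      (balance k l σ m z w h)
    where
    -- h is the shortfall of z below (m + 3)κ + m; w ≥ 0 and the τ-bounds force it to be large.
    w≥0 : suc m * (suc k + σ) ≤ h * p + σ
    w≥0 = balance⇒≤ w (≤-reflexive (sym (cong₂ _+_ (sym eq) (cong (p *_) z+h≡)))) (identity k l σ m z w h)
      where
      identity : ∀ k l σ m z w h →
        suc m * (suc k + σ) + w
          + ((3 + m) * suc ((k + l + σ) + k * suc (k + l + σ) + l) + suc (k + l + σ) * (z + h))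
        ≡ h * suc (k + l + σ) + σ
          + ((z * suc (k + l + σ) + w + (3 * l + suc k)) + suc (k + l + σ) * ((m + 3) * suc k + m))
      identity = solve-∀
    m<[2+τ]h : suc m ≤ (2 + τ) * h
    m<[2+τ]h = *-cancelʳ-< p m ((2 + τ) * h)
      (balance⇒≤ (suc m)
        (+-mono-≤ (+-mono-≤ (*-monoʳ-≤ (2 + τ) w≥0) (*-monoʳ-≤ (suc m) l<[1+τ][κ+σ])) [2+τ]σ<p)
        (identity k l σ τ m h))
      where
      identity : ∀ k l σ τ m h →
        suc (m * suc (k + l + σ)) + suc m
         + ((2 + τ) * (h * suc (k + l + σ) + σ) + suc m * (suc τ * (suc k + σ)) + suc (k + l + σ))
        ≡ (2 + τ) * h * suc (k + l + σ)
         + ((2 + τ) * (suc m * (suc k + σ)) + suc m * suc l + suc ((2 + τ) * σ))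
      identity = solve-∀
    mσ≤h[p-1] : suc m * σ ≤ h * (k + l + σ)
    mσ≤h[p-1] = *-cancelˡ-≤ (2 + τ) (begin
        (2 + τ) * (suc m * σ)       ≡⟨ x*[y*z]≡y*[x*z] (2 + τ) (suc m) σ ⟩
        suc m * ((2 + τ) * σ)       ≤⟨ *-monoʳ-≤ (suc m) (≤-pred [2+τ]σ<p) ⟩
        suc m * (k + l + σ)         ≤⟨ *-monoˡ-≤ (k + l + σ) m<[2+τ]h ⟩
        (2 + τ) * h * (k + l + σ)   ≡⟨ *-assoc (2 + τ) h (k + l + σ) ⟩
        (2 + τ) * (h * (k + l + σ)) ∎)
      where
      open ≤-Reasoning
      x*[y*z]≡y*[x*z] : ∀ x y z → x * (y * z) ≡ y * (x * z)
      x*[y*z]≡y*[x*z] = solve-∀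
    balance : ∀ k l σ m z w h →
      2 * suc k + σ + (3 + m) + 1
        + ((z * suc (k + l + σ) + w + (3 * l + suc k)) + (k + l + σ) * ((m + 3) * suc k + m)
           + h * (k + l + σ))
      ≡ z + w + 4 + ((3 + m) * suc ((k + l + σ) + k * suc (k + l + σ) + l) + (k + l + σ) * (z + h) + suc m * σ)
    balance = solve-∀
  cost-bound-[3+m]q {suc k} {l} {σ} (s≤s z≤n) refl refl _ _ m z w eq | no z≰
    with m≤n⇒∃[o]m+o≡n (≰⇒> z≰)
  ... | e , refl = ⊥-elim (m+1+n≢m _ (trans (sym (overshoot k l σ m e w)) eq))
    where
    overshoot : ∀ k l σ m e w →
      suc ((m + 3) * suc k + m + e) * suc (k + l + σ) + w + (3 * l + suc k)
      ≡ (3 + m) * suc ((k + l + σ) + k * suc (k + l + σ) + l)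
        + suc (1 + e + e * k + e * l + e * σ + 2 * k + k * m + l + m + m * σ + σ + w)
    overshoot = solve-∀

  cost-bound-[1+j]q : ∀ {κ l σ τ p q} → 1 ≤ κ → p ≡ κ + l + σ → q ≡ κ * p + l →
                      σ < l → l < suc τ * (κ + σ) → (2 + τ) * σ < p →
                      ∀ j z w → z * p + w + (3 * l + κ) ≡ suc j * q → 2 * κ + σ + suc j ≤ z + w + 4
  cost-bound-[1+j]q 1≤κ p≡ q≡ σ<l _ _ zero z w eq = cost-bound-q 1≤κ p≡ q≡ σ<l z w (trans eq (*-identityˡ _))
  cost-bound-[1+j]q 1≤κ p≡ q≡ _ _ _ (suc zero) z w eq = cost-bound-2q 1≤κ p≡ q≡ z w eq
  cost-bound-[1+j]q {τ = τ} 1≤κ p≡ q≡ _ l<[1+τ][κ+σ] [2+τ]σ<p (suc (suc m)) z w eq =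
    cost-bound-[3+m]q {τ = τ} 1≤κ p≡ q≡ l<[1+τ][κ+σ] [2+τ]σ<p m z w eq

  cost-bound : ∀ {κ l σ τ p q} → 1 ≤ κ → p ≡ κ + l + σ → q ≡ κ * p + l →
               σ < l → l < suc τ * (κ + σ) → (2 + τ) * σ < p →
               ∀ t y z w → y * q + z * p + w + (3 * l + κ) ≡ t * (p * q) →
               t + (3 * κ + l + 2 * σ) ≤ y + z + w + 5
  cost-bound {suc k} {l} {σ} {τ} {p} {q} (s≤s z≤n) refl refl σ<l l<[1+τ][κ+σ] [2+τ]σ<p = go
    where
    c K : ℕ
    c = 3 * l + suc k
    K = 3 * suc k + l + 2 * σ
    go : ∀ t y z w → y * q + z * p + w + c ≡ t * (p * q) → t + K ≤ y + z + w + 5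
    go zero y z w eq = ⊥-elim (1+n≢0 (m+n≡0⇒n≡0 (3 * l) (m+n≡0⇒n≡0 (y * q + z * p + w) eq)))
    go (suc t) y z w eq with p ≤? y
    ... | yes p≤y with m≤n⇒∃[o]m+o≡n p≤y
    ...   | y′ , refl =
      balance⇒≤ 0 (+-mono-≤ (go t y′ z w eq′) (s≤s z≤n)) (balance t K y′ z w p)
      where
      eq′ : y′ * q + z * p + w + c ≡ t * (p * q)
      eq′ = +-cancelˡ-≡ (p * q) _ _ (trans (shift p q y′ z w c) eq)
        where
        shift : ∀ p q y z w c → p * q + (y * q + z * p + w + c) ≡ (p + y) * q + z * p + w + c
        shift = solve-∀
      balance : ∀ t K y z w p → suc t + K + 0 + (y + z + w + 5 + p) ≡ p + y + z + w + 5 + (t + K + 1)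
      balance = solve-∀
    go (suc t) y z w eq | no p≰y with q ≤? z
    ... | yes q≤z with m≤n⇒∃[o]m+o≡n q≤z
    ...   | z′ , refl =
      balance⇒≤ 0 (+-mono-≤ (go t y z′ w eq′) (s≤s z≤n)) (balance t K y z′ w q)
      where
      eq′ : y * q + z′ * p + w + c ≡ t * (p * q)
      eq′ = +-cancelˡ-≡ (p * q) _ _ (trans (shift p q y z′ w c) eq)
        where
        shift : ∀ p q y z w c → p * q + (y * q + z * p + w + c) ≡ y * q + (q + z) * p + w + c
        shift = solve-∀
      balance : ∀ t K y z w q → suc t + K + 0 + (y + z + w + 5 + q) ≡ y + (q + z) + w + 5 + (t + K + 1)
      balance = solve-∀
    -- y = p − (1 + j) leaves zp + w + c = (1 + j)q.
    go (suc zero) y z w eq | no p≰y | no _ with m≤n⇒∃[o]m+o≡n (≰⇒> p≰y)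
    ... | j , y+j≡p =
      balance⇒≤ 0
        (+-mono-≤ (≤-reflexive (sym y+j≡p))
                  (cost-bound-[1+j]q {τ = τ} (s≤s z≤n) refl refl σ<l l<[1+τ][κ+σ] [2+τ]σ<p j z w eq′))
        (balance k l σ y j z w)
      where
      eq′ : z * p + w + c ≡ suc j * q
      eq′ = +-cancelˡ-≡ (y * q) _ _ (begin
        y * q + (z * p + w + c)   ≡⟨ +-assoc-4 (y * q) (z * p) w c ⟩
        y * q + z * p + w + c     ≡⟨ eq ⟩
        1 * (p * q)               ≡⟨ cong (λ x → 1 * (x * q)) (sym y+j≡p) ⟩
        1 * ((suc y + j) * q)     ≡⟨ split y j q ⟩
        y * q + suc j * q         ∎)
        where
        open ≡-Reasoning
        +-assoc-4 : ∀ a b c d → a + (b + c + d) ≡ a + b + c + d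
        +-assoc-4 = solve-∀
        split : ∀ y j q → 1 * ((suc y + j) * q) ≡ y * q + suc j * q
        split = solve-∀
      balance : ∀ k l σ y j z w →
        1 + (3 * suc k + l + 2 * σ) + 0 + (suc y + j + (z + w + 4))
        ≡ y + z + w + 5 + (suc (k + l + σ) + (2 * suc k + σ + suc j))
      balance = solve-∀
    -- With y < p and z < q, w alone is at least (t − 2)pq + p + q − c.
    go (suc (suc t)) y z w eq | no p≰y | no q≰z
      with m≤n⇒∃[o]m+o≡n (≰⇒> p≰y) | m≤n⇒∃[o]m+o≡n (≰⇒> q≰z)
    ... | Y , y+Y≡p | Z , z+Z≡q =
      balance⇒≤
        (t * ((k + l + σ) * q + ((k + l + σ) + k * p + l)) + Y * ((k + l + σ) + k * p + l) + Z * (k + l + σ)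
          + 2 * suc k * (k + l + σ) + 1)
        (≤-reflexive (sym (cong₂ _+_ (cong₂ _+_ eq (cong (((k + l + σ) + k * p + l) *_) (sym y+Y≡p)))
                                      (cong ((k + l + σ) *_) (sym z+Z≡q)))))
        (balance k l σ t y z w Y Z)
      where
      balance : ∀ k l σ t y z w Y Z →
        suc (suc t) + (3 * suc k + l + 2 * σ)
         + (t * ((k + l + σ) * suc ((k + l + σ) + k * suc (k + l + σ) + l) + ((k + l + σ) + k * suc (k + l + σ) + l))
            + Y * ((k + l + σ) + k * suc (k + l + σ) + l) + Z * (k + l + σ) + 2 * suc k * (k + l + σ) + 1)
         + (y * suc ((k + l + σ) + k * suc (k + l + σ) + l) + z * suc (k + l + σ) + w + (3 * l + suc k)
            + ((k + l + σ) + k * suc (k + l + σ) + l) * suc (k + l + σ)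
            + (k + l + σ) * suc ((k + l + σ) + k * suc (k + l + σ) + l))
        ≡ y + z + w + 5
         + (suc (suc t) * (suc (k + l + σ) * suc ((k + l + σ) + k * suc (k + l + σ) + l))
            + ((k + l + σ) + k * suc (k + l + σ) + l) * (suc y + Y)
            + (k + l + σ) * (suc z + Z))
      balance = solve-∀

  double-representation : ∀ {p q} → Odd p → Odd q → ∀ x y z w →
    2 * (x * (p * q) + y * (half p * q) + z * (p * half q) + w * half (p * q)) + (y * q + z * p + w)
    ≡ (2 * x + y + z + w) * (p * q)
  double-representation p-odd q-odd x y z w = doubled p-odd q-odd (half-*-odd p-odd q-odd)
    where
    doubled : ∀ {p q b a d} → p ≡ 1 + 2 * b → q ≡ 1 + 2 * a → d ≡ 2 * a * b + a + b →
      2 * (x * (p * q) + y * (b * q) + z * (p * a) + w * d) + (y * q + z * p + w) ≡ (2 * x + y + z + w) * (p * q)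
    doubled {b = b} {a} refl refl refl = solve (x ∷ y ∷ z ∷ w ∷ b ∷ a ∷ [])

  no-doubled-representation : ∀ {κ l σ τ p q} → 1 ≤ κ → p ≡ κ + l + σ → q ≡ κ * p + l →
    σ < l → l < suc τ * (κ + σ) → (2 + τ) * σ < p →
    ∀ R x y z w → 2 * R + (y * q + z * p + w) ≡ (2 * x + y + z + w) * (p * q) →
    2 * R + 6 * (p * q) ≢ (3 * κ + l + 2 * σ) * (p * q) + (3 * l + κ)
  no-doubled-representation {κ} {l} {σ} {τ} {p} {q} 1≤κ p≡ q≡ σ<l l<[1+τ][κ+σ] [2+τ]σ<p
                            R x y z w doubled doubled-g₁ =
    1+n≰n {y + z + w + 5} (balance⇒≤ (2 * x) n+6≤y+z+w+5 (identity x y z w))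
    where
    pq r c K n : ℕ
    pq = p * q
    r = y * q + z * p + w
    c = 3 * l + κ
    K = 3 * κ + l + 2 * σ
    n = 2 * x + y + z + w
    open ≡-Reasoning
    expand : (n + 6) * pq ≡ K * pq + (r + c)
    expand = begin
      (n + 6) * pq         ≡⟨ *-distribʳ-+ pq n 6 ⟩
      n * pq + 6 * pq      ≡⟨ cong (_+ 6 * pq) (sym doubled) ⟩
      2 * R + r + 6 * pq   ≡⟨ swap (2 * R) r (6 * pq) ⟩
      2 * R + 6 * pq + r   ≡⟨ cong (_+ r) doubled-g₁ ⟩
      K * pq + c + r       ≡⟨ +-assoc (K * pq) c r ⟩
      K * pq + (c + r)     ≡⟨ cong (K * pq +_) (+-comm c r) ⟩
      K * pq + (r + c)     ∎
      where
      swap : ∀ a b c → a + b + c ≡ a + c + b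
      swap = solve-∀
    K<n+6 : K < n + 6
    K<n+6 = *-cancelʳ-< pq K (n + 6) (≤-trans (m<m+n (K * pq) 0<r+c) (≤-reflexive (sym expand)))
      where
      0<r+c : 0 < r + c
      0<r+c = ≤-trans 1≤κ (≤-trans (m≤n+m κ (3 * l)) (m≤n+m c r))
    t : ℕ
    t = n + 6 ∸ K
    K+t≡n+6 : K + t ≡ n + 6
    K+t≡n+6 = m+[n∸m]≡n (<⇒≤ K<n+6)
    t-multiple : r + c ≡ t * pq
    t-multiple = sym (+-cancelˡ-≡ (K * pq) _ _ (begin
      K * pq + t * pq    ≡⟨ sym (*-distribʳ-+ pq K t) ⟩
      (K + t) * pq       ≡⟨ cong (_* pq) K+t≡n+6 ⟩
      (n + 6) * pq       ≡⟨ expand ⟩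
      K * pq + (r + c)   ∎))
    n+6≤y+z+w+5 : n + 6 ≤ y + z + w + 5
    n+6≤y+z+w+5 = ≤-trans (≤-reflexive (trans (sym K+t≡n+6) (+-comm K t)))
      (cost-bound {τ = τ} 1≤κ p≡ q≡ σ<l l<[1+τ][κ+σ] [2+τ]σ<p t y z w t-multiple)
    identity : ∀ x y z w →
      1 + (y + z + w + 5) + 2 * x + (y + z + w + 5) ≡ y + z + w + 5 + (2 * x + y + z + w + 6)
    identity = solve-∀

module IntegerArithmetic where

  open import Data.Nat as ℕ using (ℕ)
  import Data.Nat.Properties as ℕ
  open import Data.Integer
  open import Data.Integer.Properties using (pos-*; +-injective; m⊖n≤m; ≤-<-trans; <-irrefl; ≮⇒≥)
  open import Data.Integer.Tactic.RingSolver using (solve-∀; solve)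
  open import Data.List.Base using (_∷_; [])
  open import Data.Product using (_×_; _,_)
  open import Data.Empty using (⊥-elim)
  open import Relation.Nullary using (¬_)
  open import Relation.Binary.PropositionalEquality
  open NaturalArithmetic using (Odd; half-*-odd; double-representation; no-doubled-representation)

  f-nonneg : ∀ p q x y z w → f p q (+ x) (+ y) (+ z) (+ w)
    ≡ + (x ℕ.* (p ℕ.* q) ℕ.+ y ℕ.* (half p ℕ.* q) ℕ.+ z ℕ.* (p ℕ.* half q) ℕ.+ w ℕ.* half (p ℕ.* q))
  f-nonneg p q x y z w =
    sym (cong₂ _+_ (cong₂ _+_ (cong₂ _+_ (pos-* x _) (pos-* y _)) (pos-* z _)) (pos-* w _))

  pos-odd : ∀ {n} b → n ≡ 1 ℕ.+ 2 ℕ.* b → + n ≡ + 1 + + 2 * + b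
  pos-odd b refl = cong (_+_ (+ 1)) (pos-* 2 b)

  pos-+-cancelˡ : ∀ x {y z} → x ℕ.+ y ≡ z → + y ≡ + z - + x
  pos-+-cancelˡ x {y} refl = cancel (+ x) (+ y)
    where
    cancel : ∀ X Y → Y ≡ X + Y - X
    cancel = solve-∀

  doubled-g₁-identity : ∀ {B A K L′ P Q O L S D₀ D₁ D₂ D₃ : ℤ} →
    P ≡ + 1 + + 2 * B → Q ≡ + 1 + + 2 * A → A ≡ K * B + L′ →
    O ≡ + 1 + + 2 * L′ → L ≡ O - K → S ≡ P - O →
    D₀ ≡ P * Q → D₁ ≡ B * Q → D₂ ≡ P * A → D₃ ≡ + 2 * A * B + A + B →
    + 2 * ((B - + 1) * D₀ + (P - + 1) * D₁ + K * D₂ + -1ℤ * D₃ - L * D₃ + L′) + + 6 * D₀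
    ≡ (+ 3 * K + L + + 2 * S) * D₀ + (+ 3 * L + K)
  doubled-g₁-identity {B} {_} {K} {L′} refl refl refl refl refl refl refl refl refl refl =
    solve (B ∷ K ∷ L′ ∷ [])

  doubled-g₁+λ′ : ∀ {p q κ l l′ σ} → Odd p → Odd q → half q ≡ κ ℕ.* half p ℕ.+ l′ →
    κ ℕ.+ l ≡ 1 ℕ.+ 2 ℕ.* l′ → p ≡ κ ℕ.+ l ℕ.+ σ →
    + 2 * (g₁ p q κ l + + l′) + + (6 ℕ.* (p ℕ.* q))
    ≡ + ((3 ℕ.* κ ℕ.+ l ℕ.+ 2 ℕ.* σ) ℕ.* (p ℕ.* q) ℕ.+ (3 ℕ.* l ℕ.+ κ))
  doubled-g₁+λ′ {p} {q} {κ} {l} {l′} {σ} p-odd q-odd q′≡κp′+l′ κ+l≡1+2l′ p≡κ+l+σ = begin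
    + 2 * (g₁ p q κ l + + l′) + + (6 ℕ.* (p ℕ.* q))
      ≡⟨ cong (_+_ (+ 2 * (g₁ p q κ l + + l′))) (pos-* 6 (p ℕ.* q)) ⟩
    + 2 * (g₁ p q κ l + + l′) + + 6 * + (p ℕ.* q)
      ≡⟨ doubled-g₁-identity {K = + κ} (pos-odd b p-odd) (pos-odd a q-odd) A≡KB+L′ (pos-odd l′ refl)
           (pos-+-cancelˡ κ κ+l≡1+2l′) (pos-+-cancelˡ (1 ℕ.+ 2 ℕ.* l′) 1+2l′+σ≡p)
           (pos-* p q) (pos-* (half p) q) (pos-* p (half q)) D₃≡2AB+A+B ⟩
    (+ 3 * + κ + + l + + 2 * + σ) * + (p ℕ.* q) + (+ 3 * + l + + κ)
      ≡⟨ sym (cong₂ _+_ (trans (pos-* (3 ℕ.* κ ℕ.+ l ℕ.+ 2 ℕ.* σ) (p ℕ.* q))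
                                (cong (_* + (p ℕ.* q)) (cong₂ _+_ (cong (_+ + l) (pos-* 3 κ)) (pos-* 2 σ))))
                         (cong (_+ + κ) (pos-* 3 l))) ⟩
    + ((3 ℕ.* κ ℕ.+ l ℕ.+ 2 ℕ.* σ) ℕ.* (p ℕ.* q) ℕ.+ (3 ℕ.* l ℕ.+ κ))   ∎
    where
    open ≡-Reasoning
    a b : ℕ
    a = half q
    b = half p
    1+2l′+σ≡p : 1 ℕ.+ 2 ℕ.* l′ ℕ.+ σ ≡ p
    1+2l′+σ≡p = trans (cong (ℕ._+ σ) (sym κ+l≡1+2l′)) (sym p≡κ+l+σ)
    A≡KB+L′ : + a ≡ + κ * + b + + l′
    A≡KB+L′ = trans (cong +_ q′≡κp′+l′) (cong (_+ + l′) (pos-* κ b))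
    D₃≡2AB+A+B : + half (p ℕ.* q) ≡ + 2 * + a * + b + + a + + b
    D₃≡2AB+A+B = trans (cong +_ (half-*-odd p-odd q-odd))
                       (cong (λ x → x + + a + + b) (trans (pos-* (2 ℕ.* a) b) (cong (_* + b) (pos-* 2 a))))

  positive-of-double : ∀ G {m n} → m ℕ.< n → + 2 * G + + m ≡ + n → + 0 < G
  positive-of-double (+ ℕ.suc _) _ _ = +<+ (ℕ.s≤s ℕ.z≤n)
  positive-of-double (+ 0) m<n eq = ⊥-elim (ℕ.<-irrefl (+-injective eq) m<n)
  positive-of-double -[1+ g ] {m} m<n eq =
    ⊥-elim (<-irrefl refl (≤-<-trans (subst (_≤ + m) eq (m⊖n≤m m (2 ℕ.* ℕ.suc g))) (+<+ m<n)))

  unrepresentable≤frobenius : ∀ {p q n} → ¬ Representable p q n → ∀ g → IsFrobenius p q g → n ≤ g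
  unrepresentable≤frobenius unrepresentable g (_ , _ , above-g-representable) =
    ≮⇒≥ (λ g<n → unrepresentable (above-g-representable _ g<n))

  g₁+λ′-positive-unrepresentable : ∀ {p q κ l l′ σ τ} → Odd p → Odd q →
    half q ≡ κ ℕ.* half p ℕ.+ l′ → κ ℕ.+ l ≡ 1 ℕ.+ 2 ℕ.* l′ → p ≡ κ ℕ.+ l ℕ.+ σ → q ≡ κ ℕ.* p ℕ.+ l →
    1 ℕ.≤ κ → 1 ℕ.≤ σ → σ ℕ.< l → l ℕ.< ℕ.suc τ ℕ.* (κ ℕ.+ σ) → (2 ℕ.+ τ) ℕ.* σ ℕ.< p →
    + 0 < g₁ p q κ l + + l′ × ¬ Representable p q (g₁ p q κ l + + l′)
  g₁+λ′-positive-unrepresentable {p} {q} {κ} {l} {l′} {σ} {τ}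
    p-odd q-odd q′≡κp′+l′ κ+l≡1+2l′ p≡κ+l+σ q≡κp+l 1≤κ 1≤σ σ<l l<[1+τ][κ+σ] [2+τ]σ<p =
    positive-of-double G 6pq<Kpq+c doubled , unrepresentable
    where
    G : ℤ
    G = g₁ p q κ l + + l′
    K c : ℕ
    K = 3 ℕ.* κ ℕ.+ l ℕ.+ 2 ℕ.* σ
    c = 3 ℕ.* l ℕ.+ κ
    doubled : + 2 * G + + (6 ℕ.* (p ℕ.* q)) ≡ + (K ℕ.* (p ℕ.* q) ℕ.+ c)
    doubled = doubled-g₁+λ′ {p} {q} {κ} {l} {l′} {σ} p-odd q-odd q′≡κp′+l′ κ+l≡1+2l′ p≡κ+l+σ
    6pq<Kpq+c : 6 ℕ.* (p ℕ.* q) ℕ.< K ℕ.* (p ℕ.* q) ℕ.+ c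
    6pq<Kpq+c =
      ℕ.≤-<-trans (ℕ.*-monoˡ-≤ (p ℕ.* q) 6≤K) (ℕ.m<m+n _ (ℕ.≤-trans 1≤κ (ℕ.m≤n+m κ (3 ℕ.* l))))
      where
      6≤K : 6 ℕ.≤ K
      6≤K =
        ℕ.+-mono-≤ (ℕ.+-mono-≤ (ℕ.*-monoʳ-≤ 3 1≤κ) (ℕ.≤-trans (ℕ.s≤s ℕ.z≤n) σ<l)) (ℕ.*-monoʳ-≤ 2 1≤σ)
    unrepresentable : ¬ Representable p q G
    unrepresentable (x , y , z , w , G≡f) =
      no-doubled-representation {τ = τ} 1≤κ p≡κ+l+σ q≡κp+l σ<l l<[1+τ][κ+σ] [2+τ]σ<p R x y z w
        (double-representation p-odd q-odd x y z w) (+-injective (begin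
          + (2 ℕ.* R ℕ.+ 6 ℕ.* (p ℕ.* q))  ≡⟨ cong (λ n → n + + (6 ℕ.* (p ℕ.* q))) (pos-* 2 R) ⟩
          + 2 * + R + + (6 ℕ.* (p ℕ.* q))  ≡⟨ cong (λ n → + 2 * n + + (6 ℕ.* (p ℕ.* q))) G≡+R ⟩
          + 2 * G + + (6 ℕ.* (p ℕ.* q))    ≡⟨ doubled ⟩
          + (K ℕ.* (p ℕ.* q) ℕ.+ c)        ∎))
      where
      open ≡-Reasoning
      R : ℕ
      R = x ℕ.* (p ℕ.* q) ℕ.+ y ℕ.* (half p ℕ.* q) ℕ.+ z ℕ.* (p ℕ.* half q) ℕ.+ w ℕ.* half (p ℕ.* q)
      G≡+R : + R ≡ G
      G≡+R = sym (trans G≡f (f-nonneg p q x y z w))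

open NaturalArithmetic
open IntegerArithmetic

open import Data.Nat as ℕ using (ℕ; _∸_)
import Data.Nat.Properties as ℕ
open import Data.Nat.Primality using (Prime)
open import Data.Integer using (+_; _+_; _<_; +<+)
open import Data.Integer.Properties using (<-≤-trans; +-monoʳ-<; +-identityʳ)
open import Data.Product using (_×_; _,_; proj₁; proj₂)
open import Relation.Binary.PropositionalEquality using (_≡_; sym; trans; cong; subst)
open import Relation.Nullary using (¬_)

proposition7p5 :
    (p q κ l κ′ l′ τ : ℕ) →
    Prime p → Prime q → 2 ℕ.< p → p ℕ.< q →
    -- q = κ p + λ, 1 ≤ λ ≤ p - 1
    q ≡ κ ℕ.* p ℕ.+ l → 1 ℕ.≤ l → l ℕ.≤ p ∸ 1 →
    -- q' = κ' p' + λ', 0 ≤ λ' ≤ p' - 1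
    half q ≡ κ′ ℕ.* half p ℕ.+ l′ → l′ ℕ.< half p →
    -- κ + λ < p
    κ ℕ.+ l ℕ.< p →
    -- τ = ⌊ λ / (p - λ) ⌋
    τ ℕ.* (p ∸ l) ℕ.≤ l → l ℕ.< ℕ.suc τ ℕ.* (p ∸ l) →
    TypeII (half p) l′ τ →
    p ∸ l ℕ.< κ ℕ.+ l →
    ((+ 0 < g₁ p q κ l + + l′) × ¬ Representable p q (g₁ p q κ l + + l′))
    × (∀ g → IsFrobenius p q g → g₁ p q κ l < g)
proposition7p5 p q κ l κ′ l′ τ p-prime q-prime 2<p p<q q≡κp+l _ l≤p∸1 q′≡κ′p′+l′ l′<p′ κ+l<p
               _ l<[1+τ][p∸l] typeII p∸l<κ+l =
  positive-unrepresentable ,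
  λ g g-frobenius →
    <-≤-trans g₁<g₁+λ′ (unrepresentable≤frobenius {p} {q} (proj₂ positive-unrepresentable) g g-frobenius)
  where
  p-odd : Odd p
  p-odd = odd-prime p-prime 2<p
  q-odd : Odd q
  q-odd = odd-prime q-prime (ℕ.<-trans 2<p p<q)
  normalised : half q ≡ κ ℕ.* half p ℕ.+ l′ × κ ℕ.+ l ≡ 1 ℕ.+ 2 ℕ.* l′
  normalised = normal-form {p} {q} {κ} {l} {κ′} {l′} p-odd q-odd q≡κp+l q′≡κ′p′+l′ l′<p′ κ+l<p
  σ : ℕ
  σ = p ∸ (κ ℕ.+ l)
  p≡κ+l+σ : p ≡ κ ℕ.+ l ℕ.+ σ
  p≡κ+l+σ = sym (ℕ.m+[n∸m]≡n (ℕ.<⇒≤ κ+l<p))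
  p∸l≡κ+σ : p ∸ l ≡ κ ℕ.+ σ
  p∸l≡κ+σ = ∸-split {p} {κ} {l} {σ} p≡κ+l+σ
  1≤κ : 1 ℕ.≤ κ
  1≤κ = quotient-positive p<q q≡κp+l (ℕ.≤-trans l≤p∸1 (ℕ.m∸n≤m p 1))
  σ<l : σ ℕ.< l
  σ<l = ℕ.+-cancelˡ-< κ σ l (subst (ℕ._< κ ℕ.+ l) p∸l≡κ+σ p∸l<κ+l)
  l<[1+τ][κ+σ] : l ℕ.< ℕ.suc τ ℕ.* (κ ℕ.+ σ)
  l<[1+τ][κ+σ] = subst (λ x → l ℕ.< ℕ.suc τ ℕ.* x) p∸l≡κ+σ l<[1+τ][p∸l]
  [2+τ]σ<p : (2 ℕ.+ τ) ℕ.* σ ℕ.< p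
  [2+τ]σ<p = typeII-σ-bound {p} {half p} {l′} {σ} {τ} p-odd (trans p≡κ+l+σ (cong (ℕ._+ σ) (proj₂ normalised))) typeII
  positive-unrepresentable : + 0 < g₁ p q κ l + + l′ × ¬ Representable p q (g₁ p q κ l + + l′)
  positive-unrepresentable = g₁+λ′-positive-unrepresentable {p} {q} {κ} {l} {l′} {σ} {τ}
    p-odd q-odd (proj₁ normalised) (proj₂ normalised) p≡κ+l+σ q≡κp+l
    1≤κ (ℕ.m<n⇒0<n∸m κ+l<p) σ<l l<[1+τ][κ+σ] [2+τ]σ<p
  g₁<g₁+λ′ : g₁ p q κ l < g₁ p q κ l + + l′
  g₁<g₁+λ′ = subst (_< g₁ p q κ l + + l′) (+-identityʳ (g₁ p q κ l))
    (+-monoʳ-< (g₁ p q κ l) (+<+ (typeII-λ′-positive {half p} {l′} {τ} l′<p′ typeII)))
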